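{- Let $A_1,\dots,A_n,B_1,\dots,B_m,C$ be justification formulas and $s_1,\dots,s_m$ second-sort justification terms, and suppose $$\mathsf{J}^+\vdash A_1\wedge\dots\wedge A_n\wedge B_1\wedge\dots\wedge B_m\wedge[s_1]_{\mathsf{tc}}B_1\wedge\dots\wedge[s_m]_{\mathsf{tc}}B_m\to C.$$ Then there exists a first-sort justification term $h(z_1,\dots,z_n,y_1,\dots,y_m)$ whose variables are only among the displayed first-sort variables $z_1,\dots,z_n$ and second-sort variables $y_1,\dots,y_m$, such that for arbitrary first-sort variables $z_1,\dots,z_n$ $$\mathsf{J}^+\vdash[z_1]A_1\wedge\dots\wedge[z_n]A_n\wedge[s_1]_{\mathsf{tc}}B_1\wedge\dots\wedge[s_m]_{\mathsf{tc}}B_m\to[h(z_1,\dots,z_n,s_1,\dots,s_m)]C,$$ where $h(z_1,\dots,z_n,s_1,\dots,s_m)$ denotes the result of substituting $s_i$ for $y_i$. Moreover, if the first formula has an injective proof in $\mathsf{J}^+$, then the second formula has an injective proof in $\mathsf{J}^+$.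
   Context: Justification terms of two sorts are built simultaneously from first-sort variables $x_0,x_1,\dots$, second-sort variables $y_0,y_1,\dots$ and second-sort constants $c_0,c_1,\dots$: first-sort $w::=x_i\mid(w\cdot w)\mid\mathsf{head}(s)\mid\mathsf{tail}(s)\mid(w+w)$; second-sort $s::=y_i\mid c_i\mid(s\cdot s)\mid\mathsf{ind}(w,s)\mid(s+s)$. Formulas: $A::=p_i\mid\bot\mid(A\to A)\mid[w]A\mid[s]_{\mathsf{tc}}A$; $\neg A:=A\to\bot$, $A\wedge B:=\neg(A\to\neg B)$, $A\vee B:=\neg A\to B$. $\mathsf{J}^+_0$ has the rule modus ponens and axioms (for all formulas $A,B,C$, first-sort $h,w$, second-sort $t,s$): (i) $A\to(B\to A)$; (ii) $(A\to(B\to C))\to((A\to B)\to(A\to C))$; (iii) $\neg\neg A\to A$; (iv) $[h](A\to B)\to([w]A\to[h\cdot w]B)$; (v) $[h]A\vee[w]A\to[h+w]A$; (vi) $[t]_{\mathsf{tc}}(A\to B)\to([s]_{\mathsf{tc}}A\to[t\cdot s]_{\mathsf{tc}}B)$; (vii) $[s]_{\mathsf{tc}}A\to[\mathsf{head}(s)]A$; (viii) $[s]_{\mathsf{tc}}A\to[\mathsf{tail}(s)][s]_{\mathsf{tc}}A$; (ix) $[w]A\wedge[s]_{\mathsf{tc}}(A\to[w]A)\to[\mathsf{ind}(w,s)]_{\mathsf{tc}}A$; (x) $[t]_{\mathsf{tc}}A\vee[s]_{\mathsf{tc}}A\to[t+s]_{\mathsf{tc}}A$. $\mathsf{J}^+$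 is $\mathsf{J}^+_0$ plus all formulas $[c]_{\mathsf{tc}}A$ ($c$ a constant, $A$ an axiom of $\mathsf{J}^+_0$) as additional axioms. For a proof $\pi$ in $\mathsf{J}^+$, $\mathit{cs}(\pi)$ is the set of axioms of the form $[c]_{\mathsf{tc}}A$ occurring in $\pi$; $\pi$ is injective if $[c]_{\mathsf{tc}}A,[c]_{\mathsf{tc}}B\in\mathit{cs}(\pi)$ implies $A=B$. -}

module Defs where

open import Data.Nat using (ℕ; zero; suc; _<_)
open import Data.Fin using (Fin; zero; suc)
open import Data.List using (List; []; _∷_; _++_)
open import Data.List.Membership.Propositional using (_∈_)
open import Data.Product using (_×_; _,_)
open import Relation.Binary.PropositionalEquality using (_≡_)
import Data.List as L

mutual
  data FTm : Set where
    x    : ℕ → FTm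
    _·_  : FTm → FTm → FTm
    head : STm → FTm
    tail : STm → FTm
    _⊕_  : FTm → FTm → FTm

  data STm : Set where
    y    : ℕ → STm
    c    : ℕ → STm
    _∙_  : STm → STm → STm
    ind  : FTm → STm → STm
    _⊞_  : STm → STm → STm

infixr 5 _⇒_
infix 9 [_]_ [_]tc_
infixr 6 _∧'_ _∨'_
data Fm : Set where
  p     : ℕ → Fm
  ⊥'    : Fm
  _⇒_   : Fm → Fm → Fm
  [_]_  : FTm → Fm → Fm
  [_]tc_ : STm → Fm → Fm

¬' : Fm → Fm
¬' A = A ⇒ ⊥'

_∧'_ : Fm → Fm → Fm
A ∧' B = ¬' (A ⇒ ¬' B)

_∨'_ : Fm → Fm → Fm
A ∨' B = ¬' A ⇒ B

⊤' : Fm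
⊤' = ¬' ⊥'

⋀ : List Fm → Fm
⋀ []           = ⊤'
⋀ (A ∷ [])     = A
⋀ (A ∷ B ∷ As) = A ∧' ⋀ (B ∷ As)

data Ax0 : Fm → Set where
  ax-i    : ∀ A B → Ax0 (A ⇒ (B ⇒ A))
  ax-ii   : ∀ A B C → Ax0 ((A ⇒ (B ⇒ C)) ⇒ ((A ⇒ B) ⇒ (A ⇒ C)))
  ax-iii  : ∀ A → Ax0 (¬' (¬' A) ⇒ A)
  ax-iv   : ∀ A B h w → Ax0 ([ h ] (A ⇒ B) ⇒ ([ w ] A ⇒ [ h · w ] B))
  ax-v    : ∀ A h w → Ax0 (([ h ] A ∨' [ w ] A) ⇒ [ h ⊕ w ] A)
  ax-vi   : ∀ A B t s → Ax0 ([ t ]tc (A ⇒ B) ⇒ ([ s ]tc A ⇒ [ t ∙ s ]tc B))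
  ax-vii  : ∀ A s → Ax0 ([ s ]tc A ⇒ [ head s ] A)
  ax-viii : ∀ A s → Ax0 ([ s ]tc A ⇒ [ tail s ] ([ s ]tc A))
  ax-ix   : ∀ A w s → Ax0 (([ w ] A ∧' [ s ]tc (A ⇒ [ w ] A)) ⇒ [ ind w s ]tc A)
  ax-x    : ∀ A t s → Ax0 (([ t ]tc A ∨' [ s ]tc A) ⇒ [ t ⊞ s ]tc A)

data Proof : Fm → Set where
  ax0  : ∀ {A} → Ax0 A → Proof A
  axc  : ∀ (k : ℕ) {A} → Ax0 A → Proof ([ c k ]tc A)
  mp   : ∀ {A B} → Proof (A ⇒ B) → Proof A → Proof B

cs : ∀ {A} → Proof A → List (ℕ × Fm)
cs (ax0 _)     = []
cs (axc k {A} _) = (k , A) ∷ []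
cs (mp π ρ)    = cs π ++ cs ρ

Injective : ∀ {A} → Proof A → Set
Injective π = ∀ k A B → (k , A) ∈ cs π → (k , B) ∈ cs π → A ≡ B

mutual
  FVarsIn : ℕ → ℕ → FTm → Set
  FVarsIn n m (x i)     = i < n
  FVarsIn n m (w · v)   = FVarsIn n m w × FVarsIn n m v
  FVarsIn n m (head s)  = SVarsIn n m s
  FVarsIn n m (tail s)  = SVarsIn n m s
  FVarsIn n m (w ⊕ v)   = FVarsIn n m w × FVarsIn n m v

  SVarsIn : ℕ → ℕ → STm → Set
  SVarsIn n m (y j)     = j < m
  SVarsIn n m (c k)     = Data.Unit.⊤
    where import Data.Unit
  SVarsIn n m (s ∙ t)   = SVarsIn n m s × SVarsIn n m t
  SVarsIn n m (ind w s) = FVarsIn n m w × SVarsIn n m s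
  SVarsIn n m (s ⊞ t)   = SVarsIn n m s × SVarsIn n m t

mutual
  substF : (ℕ → FTm) → (ℕ → STm) → FTm → FTm
  substF σ τ (x i)    = σ i
  substF σ τ (w · v)  = substF σ τ w · substF σ τ v
  substF σ τ (head s) = head (substS σ τ s)
  substF σ τ (tail s) = tail (substS σ τ s)
  substF σ τ (w ⊕ v)  = substF σ τ w ⊕ substF σ τ v

  substS : (ℕ → FTm) → (ℕ → STm) → STm → STm
  substS σ τ (y j)     = τ j
  substS σ τ (c k)     = c k
  substS σ τ (s ∙ t)   = substS σ τ s ∙ substS σ τ t
  substS σ τ (ind w s) = ind (substF σ τ w) (substS σ τ s)
  substS σ τ (s ⊞ t)   = substS σ τ s ⊞ substS σ τ t

-- extend a finite assignment (Fin n → X) to ℕ, using d outside the range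
ext : ∀ {n} {X : Set} → (Fin n → X) → (ℕ → X) → ℕ → X
ext {zero}  f d i       = d i
ext {suc n} f d zero    = f zero
ext {suc n} f d (suc i) = ext (λ j → f (suc j)) (λ j → d (suc j)) i

-- h(z₁,…,zₙ,s₁,…,sₘ): placeholders x_0..x_{n-1} ↦ x_{z 0}..x_{z (n-1)},
-- placeholders y_0..y_{m-1} ↦ s_0..s_{m-1}
inst : ∀ {n m} → FTm → (Fin n → ℕ) → (Fin m → STm) → FTm
inst h z s = substF (ext (λ i → x (z i)) x) (ext s y) h

premiseFm : ∀ {n m} → (Fin n → Fm) → (Fin m → Fm) → (Fin m → STm) → Fm → Fm
premiseFm A B s C =
  ⋀ (L.tabulate A ++ L.tabulate B ++ L.tabulate (λ j → [ s j ]tc B j)) ⇒ C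

conclFm : ∀ {n m} → (Fin n → Fm) → (Fin m → Fm) → (Fin m → STm) → Fm →
          FTm → (Fin n → ℕ) → Fm
conclFm A B s C h z =
  ⋀ (L.tabulate (λ i → [ x (z i) ] A i) ++ L.tabulate (λ j → [ s j ]tc B j))
    ⇒ [ inst h z s ] C

{-# OPTIONS --safe #-}
module Submission where

-- Currying turns π into a proof of A₁ ⇒ ⋯ ⇒ [sₘ]tc Bₘ ⇒ C, and this closed proof is
-- internalised by a closed term h₀: the i-th axiom leaf A gets the constant c_{o+i},
-- with o above every constant of π, so that [c_{o+i}]tc A is a new constant axiom and
-- head(c_{o+i}) justifies A (axiom vii); a leaf [c_k]tc A is justified by tail(c_k)
-- (axiom viii), and modus ponens becomes application (axiom iv). Applying h₀ to xᵢ,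
-- head(yⱼ), tail(yⱼ) gives h: after substitution Aᵢ is justified by zᵢ, Bⱼ by head(sⱼ)
-- and [sⱼ]tc Bⱼ by tail(sⱼ). The new constants are pairwise distinct and fresh for π,
-- so injectivity is preserved.

open import Defs
open import Data.Nat using (ℕ; suc; _+_; _<_; s≤s)
open import Data.Nat.Properties using (<⇒≱; +-cancelˡ-≡; m≤m+n; +-identityʳ; +-assoc)
open import Data.Fin using (Fin; toℕ) renaming (zero to fzero; suc to fsuc)
open import Data.Fin.Properties using (toℕ<n)
open import Data.Product using (Σ; ∃; _×_; _,_; proj₁)
open import Data.Sum as Sum using (inj₁; inj₂)
open import Data.Empty using (⊥-elim)
open import Data.Unit using (tt)
open import Data.List using (List; []; _∷_; _++_; length; foldl; tabulate; map)
open import Data.List.Properties using (map-++; map-tabulate; tabulate-cong)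
open import Data.List.Extrema.Nat using (max; xs≤max)
open import Data.List.Membership.Propositional using (_∈_)
open import Data.List.Membership.Propositional.Properties
  using (∈-++⁻; ∈-++⁺ˡ; ∈-++⁺ʳ; ∈-tabulate⁺; ∈-map⁺)
open import Data.List.Relation.Unary.All as All using (All; []; _∷_)
import Data.List.Relation.Unary.All.Properties as All
open import Data.List.Relation.Unary.Any using (here; there)
open import Data.List.Relation.Binary.Pointwise as Pointwise using (Pointwise; []; _∷_)
open import Function using (_∘_; id)
open import Relation.Unary using (_∪_)
open import Relation.Binary.PropositionalEquality
  using (_≡_; refl; sym; trans; cong; cong₂; subst)

infixr 5 _⇛_

_⇛_ : List Fm → Fm → Fm
[]       ⇛ C = C
(D ∷ Ds) ⇛ C = D ⇒ (Ds ⇛ C)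

ProofWithin : (ℕ × Fm → Set) → Fm → Set
ProofWithin X D = Σ (Proof D) (All X ∘ cs)

Functional : (ℕ × Fm → Set) → Set
Functional X = ∀ k A B → X (k , A) → X (k , B) → A ≡ B

injective-within : ∀ {X D} → Functional X → (ρ : ProofWithin X D) → Injective (proj₁ ρ)
injective-within X-functional (ρ , cs-in-X) k A B kA∈ kB∈ =
  X-functional k A B (All.lookup cs-in-X kA∈) (All.lookup cs-in-X kB∈)

module _ {X : ℕ × Fm → Set} where

  mpWithin : ∀ {D E} → ProofWithin X (D ⇒ E) → ProofWithin X D → ProofWithin X E
  mpWithin (π , π-in-X) (ρ , ρ-in-X) = mp π ρ , All.++⁺ π-in-X ρ-in-X

  infix 3 _⊢_

  data _⊢_ (Γ : List Fm) : Fm → Set where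
    hyp   : ∀ {D} → D ∈ Γ → Γ ⊢ D
    lemma : ∀ {D} → ProofWithin X D → Γ ⊢ D
    mp    : ∀ {D E} → Γ ⊢ D ⇒ E → Γ ⊢ D → Γ ⊢ E

  variable
    Γ : List Fm
    D E C : Fm

  axiom : Ax0 D → Γ ⊢ D
  axiom a = lemma (ax0 a , [])

  var₀ : D ∷ Γ ⊢ D
  var₀ = hyp (here refl)

  var₁ : E ∷ D ∷ Γ ⊢ D
  var₁ = hyp (there (here refl))

  var₂ : ∀ {F} → F ∷ E ∷ D ∷ Γ ⊢ D
  var₂ = hyp (there (there (here refl)))

  weaken : Γ ⊢ D → E ∷ Γ ⊢ D
  weaken (hyp D∈Γ) = hyp (there D∈Γ)
  weaken (lemma ρ) = lemma ρ
  weaken (mp d e)  = mp (weaken d) (weaken e)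

  ⇒-refl : Γ ⊢ D ⇒ D
  ⇒-refl {D = D} = mp (mp (axiom (ax-ii D (D ⇒ D) D)) (axiom (ax-i D (D ⇒ D)))) (axiom (ax-i D D))

  deduction : D ∷ Γ ⊢ E → Γ ⊢ D ⇒ E
  deduction (hyp (here refl))  = ⇒-refl
  deduction (hyp (there E∈Γ))  = mp (axiom (ax-i _ _)) (hyp E∈Γ)
  deduction (lemma ρ)          = mp (axiom (ax-i _ _)) (lemma ρ)
  deduction (mp d e)           = mp (mp (axiom (ax-ii _ _ _)) (deduction d)) (deduction e)

  close : [] ⊢ D → ProofWithin X D
  close (lemma ρ) = ρ
  close (mp d e)  = mpWithin (close d) (close e)

  ∧-intro : Γ ⊢ D → Γ ⊢ E → Γ ⊢ D ∧' E
  ∧-intro d e = deduction (mp (mp var₀ (weaken d)) (weaken e))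

  -- D ∧' E is ¬ (D ⇒ ¬ E): each projection is obtained by ¬¬-elimination (axiom iii).
  ∧-elimˡ : Γ ⊢ D ∧' E → Γ ⊢ D
  ∧-elimˡ {D = D} d =
    mp (axiom (ax-iii D)) (deduction (mp (weaken d) (deduction (deduction (mp var₂ var₁)))))

  ∧-elimʳ : Γ ⊢ D ∧' E → Γ ⊢ E
  ∧-elimʳ {E = E} d = mp (axiom (ax-iii E)) (deduction (mp (weaken d) (deduction var₁)))

  ⋀-elim : ∀ {Ds} → D ∈ Ds → Γ ⊢ ⋀ Ds → Γ ⊢ D
  ⋀-elim {Ds = _ ∷ []}    (here refl) d = d
  ⋀-elim {Ds = _ ∷ _ ∷ _} (here refl) d = ∧-elimˡ d
  ⋀-elim {Ds = _ ∷ _ ∷ _} (there D∈)  d = ⋀-elim D∈ (∧-elimʳ d)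

  ⋀-curry : ∀ Ds → Γ ⊢ ⋀ Ds ⇒ C → Γ ⊢ Ds ⇛ C
  ⋀-curry []           d = mp d ⇒-refl   -- ⋀ [] is ⊥ ⇒ ⊥
  ⋀-curry (_ ∷ [])     d = d
  ⋀-curry (_ ∷ E ∷ Ds) d =
    deduction (⋀-curry (E ∷ Ds) (deduction (mp (weaken (weaken d)) (∧-intro var₁ var₀))))

  ·-applyAll : ∀ {h ws Ds} → Γ ⊢ [ h ] (Ds ⇛ C) → Pointwise (λ w D → Γ ⊢ [ w ] D) ws Ds →
               Γ ⊢ [ foldl _·_ h ws ] C
  ·-applyAll d []       = d
  ·-applyAll d (e ∷ es) = ·-applyAll (mp (mp (axiom (ax-iv _ _ _ _)) d) e) es

module _ {V : Set} where

  infix 4 _[_]=_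

  data _[_]=_ : List V → ℕ → V → Set where
    here  : ∀ {v vs} → v ∷ vs [ 0 ]= v
    there : ∀ {u v vs i} → vs [ i ]= v → u ∷ vs [ suc i ]= v

  []=-functional : ∀ {vs i u v} → vs [ i ]= u → vs [ i ]= v → u ≡ v
  []=-functional here         here         = refl
  []=-functional (there u-at) (there v-at) = []=-functional u-at v-at

  []=-++ˡ : ∀ {us vs i v} → us [ i ]= v → us ++ vs [ i ]= v
  []=-++ˡ here         = here
  []=-++ˡ (there v-at) = there ([]=-++ˡ v-at)

  []=-++ʳ : ∀ us {vs i v} → vs [ i ]= v → us ++ vs [ length us + i ]= v
  []=-++ʳ []       v-at = v-at
  []=-++ʳ (_ ∷ us) v-at = there ([]=-++ʳ us v-at)

  freshKey : List (ℕ × V) → ℕ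
  freshKey kvs = suc (max 0 (map proj₁ kvs))

  ∈⇒<freshKey : ∀ {kvs k v} → (k , v) ∈ kvs → k < freshKey kvs
  ∈⇒<freshKey {kvs} kv∈ = s≤s (All.lookup (xs≤max 0 (map proj₁ kvs)) (∈-map⁺ proj₁ kv∈))

IndexedFrom : ℕ → List Fm → ℕ × Fm → Set
IndexedFrom o As (k , A) = ∃ λ i → k ≡ o + i × As [ i ]= A

IndexedFrom-functional : ∀ {o As} → Functional (IndexedFrom o As)
IndexedFrom-functional {o} k A B (i , refl , A-at) (j , o+i≡o+j , B-at)
  with +-cancelˡ-≡ o i j o+i≡o+j
... | refl = []=-functional A-at B-at

∪-IndexedFrom-functional : ∀ {X o As} → Functional X → (∀ {k A} → X (k , A) → k < o) →
                           Functional (X ∪ IndexedFrom o As)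
∪-IndexedFrom-functional X-functional below k A B (inj₁ kA) (inj₁ kB) = X-functional k A B kA kB
∪-IndexedFrom-functional X-functional below k A B (inj₁ kA) (inj₂ (i , refl , _)) =
  ⊥-elim (<⇒≱ (below kA) (m≤m+n _ i))
∪-IndexedFrom-functional X-functional below k A B (inj₂ (i , refl , _)) (inj₁ kB) =
  ⊥-elim (<⇒≱ (below kB) (m≤m+n _ i))
∪-IndexedFrom-functional X-functional below k A B (inj₂ kA) (inj₂ kB) =
  IndexedFrom-functional k A B kA kB

IndexedFrom-++ˡ : ∀ {o As Bs e} → IndexedFrom o As e → IndexedFrom o (As ++ Bs) e
IndexedFrom-++ˡ {e = _ , _} (i , k≡o+i , A-at) = i , k≡o+i , []=-++ˡ A-at

IndexedFrom-++ʳ : ∀ {o} As {Bs e} → IndexedFrom (o + length As) Bs e → IndexedFrom o (As ++ Bs) e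
IndexedFrom-++ʳ {o} As {e = _ , _} (i , k≡o+|As|+i , A-at) =
  length As + i , trans k≡o+|As|+i (+-assoc o _ i) , []=-++ʳ As A-at

axiomLeaves : ∀ {D} → Proof D → List Fm
axiomLeaves (ax0 {A} _) = A ∷ []
axiomLeaves (axc _ _)   = []
axiomLeaves (mp π ρ)    = axiomLeaves π ++ axiomLeaves ρ

internalTerm : ∀ {D} → ℕ → Proof D → FTm
internalTerm o (ax0 _)   = head (c o)
internalTerm o (axc k _) = tail (c k)
internalTerm o (mp π ρ)  = internalTerm o π · internalTerm (o + length (axiomLeaves π)) ρ

internalise : ∀ {D} o (π : Proof D) → Proof ([ internalTerm o π ] D)
internalise o (ax0 {A} a)   = mp (ax0 (ax-vii A (c o))) (axc o a)
internalise o (axc k {A} a) = mp (ax0 (ax-viii A (c k))) (axc k a)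
internalise o (mp {A} {B} π ρ) =
  mp (mp (ax0 (ax-iv A B _ _)) (internalise o π)) (internalise (o + length (axiomLeaves π)) ρ)

cs-internalise : ∀ {D} o (π : Proof D) {e} → e ∈ cs (internalise o π) →
                 ((_∈ cs π) ∪ IndexedFrom o (axiomLeaves π)) e
cs-internalise o (ax0 a)   (here refl) = inj₂ (0 , sym (+-identityʳ o) , here)
cs-internalise o (axc k a) e∈          = inj₁ e∈
cs-internalise o (mp π ρ)  e∈ with ∈-++⁻ (cs (internalise o π)) e∈
... | inj₁ e∈π = Sum.map ∈-++⁺ˡ IndexedFrom-++ˡ (cs-internalise o π e∈π)
... | inj₂ e∈ρ = Sum.map (∈-++⁺ʳ (cs π)) (IndexedFrom-++ʳ (axiomLeaves π))
                         (cs-internalise (o + length (axiomLeaves π)) ρ e∈ρ)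

internaliseWithin : ∀ {X D} o (ρ : ProofWithin X D) →
                    ProofWithin (X ∪ IndexedFrom o (axiomLeaves (proj₁ ρ)))
                                ([ internalTerm o (proj₁ ρ) ] D)
internaliseWithin o (ρ , ρ-in-X) =
  internalise o ρ , All.tabulate (Sum.map₁ (All.lookup ρ-in-X) ∘ cs-internalise o ρ)

internalTerm-FVarsIn : ∀ {D} n m o (π : Proof D) → FVarsIn n m (internalTerm o π)
internalTerm-FVarsIn n m o (ax0 _)   = tt
internalTerm-FVarsIn n m o (axc _ _) = tt
internalTerm-FVarsIn n m o (mp π ρ)  = internalTerm-FVarsIn n m o π , internalTerm-FVarsIn n m _ ρ

substF-internalTerm : ∀ {D} σ τ o (π : Proof D) → substF σ τ (internalTerm o π) ≡ internalTerm o π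
substF-internalTerm σ τ o (ax0 _)   = refl
substF-internalTerm σ τ o (axc _ _) = refl
substF-internalTerm σ τ o (mp π ρ)  =
  cong₂ _·_ (substF-internalTerm σ τ o π) (substF-internalTerm σ τ _ ρ)

premises : ∀ {n m} → (Fin n → Fm) → (Fin m → Fm) → (Fin m → STm) → List Fm
premises A B s = tabulate A ++ tabulate B ++ tabulate (λ j → [ s j ]tc B j)

premiseArgs : ∀ {n m} → (Fin n → FTm) → (Fin m → STm) → List FTm
premiseArgs u t = tabulate u ++ tabulate (head ∘ t) ++ tabulate (tail ∘ t)

FVarsIn-foldl : ∀ {n m h ws} → FVarsIn n m h → All (FVarsIn n m) ws → FVarsIn n m (foldl _·_ h ws)
FVarsIn-foldl h-vars []                  = h-vars
FVarsIn-foldl h-vars (w-vars ∷ ws-vars) = FVarsIn-foldl (h-vars , w-vars) ws-vars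

premiseArgs-FVarsIn : ∀ n m → All (FVarsIn n m) (premiseArgs (x ∘ toℕ {n}) (y ∘ toℕ {m}))
premiseArgs-FVarsIn n m =
  All.++⁺ (All.tabulate⁺ {f = x ∘ toℕ} toℕ<n)
          (All.++⁺ (All.tabulate⁺ {f = head ∘ y ∘ toℕ} toℕ<n)
                   (All.tabulate⁺ {f = tail ∘ y ∘ toℕ} toℕ<n))

substF-foldl : ∀ σ τ h ws →
               substF σ τ (foldl _·_ h ws) ≡ foldl _·_ (substF σ τ h) (map (substF σ τ) ws)
substF-foldl σ τ h []       = refl
substF-foldl σ τ h (w ∷ ws) = substF-foldl σ τ (h · w) ws

substF-premiseArgs : ∀ {n m} σ τ {u u' : Fin n → FTm} {t t' : Fin m → STm} →
                     (∀ i → substF σ τ (u i) ≡ u' i) → (∀ j → substS σ τ (t j) ≡ t' j) →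
                     map (substF σ τ) (premiseArgs u t) ≡ premiseArgs u' t'
substF-premiseArgs σ τ {u} {t = t} u≡ t≡ =
  trans (map-++ (substF σ τ) (tabulate u) _)
    (cong₂ _++_ (map-tabulate≗ u u≡)
      (trans (map-++ (substF σ τ) (tabulate (head ∘ t)) _)
        (cong₂ _++_ (map-tabulate≗ (head ∘ t) (cong head ∘ t≡))
                    (map-tabulate≗ (tail ∘ t) (cong tail ∘ t≡)))))
  where
  map-tabulate≗ : ∀ {k} (f : Fin k → FTm) {g} → (∀ i → substF σ τ (f i) ≡ g i) →
                  map (substF σ τ) (tabulate f) ≡ tabulate g
  map-tabulate≗ f f≡ = trans (map-tabulate f (substF σ τ)) (tabulate-cong f≡)

ext-toℕ : ∀ {n} {V : Set} (f : Fin n → V) d i → ext f d (toℕ i) ≡ f i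
ext-toℕ f d fzero    = refl
ext-toℕ f d (fsuc i) = ext-toℕ (f ∘ fsuc) (d ∘ suc) i

inst-applyAll : ∀ {n m} h₀ (z : Fin n → ℕ) (s : Fin m → STm) → (∀ σ τ → substF σ τ h₀ ≡ h₀) →
                inst (foldl _·_ h₀ (premiseArgs (x ∘ toℕ {n}) (y ∘ toℕ {m}))) z s ≡
                foldl _·_ h₀ (premiseArgs (x ∘ z) s)
inst-applyAll {n} {m} h₀ z s h₀-closed =
  trans (substF-foldl σ τ h₀ (premiseArgs (x ∘ toℕ {n}) (y ∘ toℕ {m})))
        (cong₂ (foldl _·_) (h₀-closed σ τ)
                           (substF-premiseArgs σ τ (ext-toℕ (x ∘ z) x) (ext-toℕ s y)))
  where
  σ : ℕ → FTm
  σ = ext (x ∘ z) x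
  τ : ℕ → STm
  τ = ext s y

conclusion-from-internalised :
  ∀ {X n m} (A : Fin n → Fm) (B : Fin m → Fm) s C {h₀} h z →
  inst h z s ≡ foldl _·_ h₀ (premiseArgs (x ∘ z) s) →
  ProofWithin X ([ h₀ ] (premises A B s ⇛ C)) → ProofWithin X (conclFm A B s C h z)
conclusion-from-internalised {X} A B s C {h₀} h z h-inst h₀-justifies =
  subst (λ t → ProofWithin X (⋀ hyps ⇒ [ t ] C)) (sym h-inst)
    (close (deduction (·-applyAll (lemma h₀-justifies) justified-premises)))
  where
  hyps : List Fm
  hyps = tabulate (λ i → [ x (z i) ] A i) ++ tabulate (λ j → [ s j ]tc B j)

  justified-premises :
    Pointwise (λ w D → ⋀ hyps ∷ [] ⊢ [ w ] D) (premiseArgs (x ∘ z) s) (premises A B s)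
  justified-premises =
    Pointwise.++⁺ (Pointwise.tabulate⁺ zᵢ-justifies)
      (Pointwise.++⁺ (Pointwise.tabulate⁺ λ j → mp (axiom (ax-vii (B j) (s j))) (sⱼ-justifies j))
                     (Pointwise.tabulate⁺ λ j → mp (axiom (ax-viii (B j) (s j))) (sⱼ-justifies j)))
    where
    zᵢ-justifies : ∀ i → ⋀ hyps ∷ [] ⊢ [ x (z i) ] A i
    zᵢ-justifies i = ⋀-elim {Ds = hyps} (∈-++⁺ˡ (∈-tabulate⁺ i)) var₀
    sⱼ-justifies : ∀ j → ⋀ hyps ∷ [] ⊢ [ s j ]tc B j
    sⱼ-justifies j = ⋀-elim {Ds = hyps} (∈-++⁺ʳ _ (∈-tabulate⁺ j)) var₀

mainTheorem7 : ∀ {n m} (A : Fin n → Fm) (B : Fin m → Fm) (s : Fin m → STm) (C : Fm) →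
    (π : Proof (premiseFm A B s C)) →
    Σ FTm (λ h → FVarsIn n m h ×
      ((z : Fin n → ℕ) → Σ (Proof (conclFm A B s C h z)) (λ ρ → Injective π → Injective ρ)))
mainTheorem7 {n} {m} A B s C π =
  h , FVarsIn-foldl (internalTerm-FVarsIn n m o π⇛) (premiseArgs-FVarsIn n m) ,
  λ z → proj₁ (ρ z) , λ π-injective → injective-within (functional π-injective) (ρ z)
  where
  curried : ProofWithin (_∈ cs π) (premises A B s ⇛ C)
  curried = close (⋀-curry (premises A B s) (lemma (π , All.tabulate id)))

  π⇛ : Proof (premises A B s ⇛ C)
  π⇛ = proj₁ curried

  o : ℕ
  o = freshKey (cs π)

  h₀ : FTm
  h₀ = internalTerm o π⇛

  h : FTm
  h = foldl _·_ h₀ (premiseArgs (x ∘ toℕ {n}) (y ∘ toℕ {m}))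

  X : ℕ × Fm → Set
  X = (_∈ cs π) ∪ IndexedFrom o (axiomLeaves π⇛)

  ρ : (z : Fin n → ℕ) → ProofWithin X (conclFm A B s C h z)
  ρ z = conclusion-from-internalised A B s C h z
          (inst-applyAll h₀ z s (λ σ τ → substF-internalTerm σ τ o π⇛))
          (internaliseWithin o curried)

  functional : Injective π → Functional X
  functional π-injective = ∪-IndexedFrom-functional π-injective ∈⇒<freshKey
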